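{- The Maximum Matching decision problem cannot be expressed in existential second-order universal Horn logic, even assuming that the input structures come with a successor relation. Here Maximum Matching is: given a finite undirected graph $G=(V,E)$ without self-loops and with at most one edge between any pair of vertices, and a non-negative integer $K \le |V|$ (part of the input, varying from instance to instance), decide whether there is a matching $F \subseteq E$ with $|F| \ge K$.
   Context: An ESO universal Horn sentence over an input (first-order) vocabulary $\sigma$ is a sentence of the form $\exists R_1 \cdots \exists R_k\, \forall \bar{x}\, \psi$, where $R_1,\dots,R_k$ are second-order (quantified) relation variables not in $\sigma$, and $\psi$ is a quantifier-free formula that is a conjunction of clauses (disjunctions of literals) in which each clause contains at most one positive occurrence of an atom built from $R_1,\dots,R_k$; atoms over $\sigma$ are unrestricted. A problem is expressed by such a sentence if exactly the input structures that are yes-instances satisfy it. A successor relation on a finite universe $\{0,\dots,m\}$ is $\{(i,i+1): 0\le i<m\}$, included in the input vocabulary. A matching is a set of edges no two of which share an endpoint. -}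

module Defs where

open import Data.Nat using (ℕ; zero; suc; _≤_; _≡ᵇ_)
open import Data.Bool using (T?; Bool; true; false; not; _∧_; _∨_; if_then_else_)
open import Data.Fin using (Fin; toℕ; _≟_) renaming (zero to fzero; suc to fsuc)
open import Data.Vec using (Vec; []; _∷_; map)
open import Data.List using (List; []; _∷_; length; lookup; filter; allFin)
open import Data.Bool.ListAction using (any; all)
open import Data.Maybe using (Maybe; just; nothing)
open import Data.Product using (Σ; _×_; _,_; proj₁; proj₂; ∃-syntax)
open import Relation.Nullary using (¬_)
open import Relation.Nullary.Decidable using (⌊_⌋)
open import Relation.Binary.PropositionalEquality using (_≡_; _≢_)
open import Function.Bundles using (_⇔_)

-- A (relational) vocabulary is the list of arities of its relation symbols.
Vocab : Set
Vocab = List ℕ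

Sym : Vocab → Set
Sym σ = Fin (length σ)

arity : (σ : Vocab) → Sym σ → ℕ
arity σ i = lookup σ i

Interp : Vocab → ℕ → Set
Interp σ N = (i : Sym σ) → Vec (Fin N) (arity σ i) → Bool

-- A finite σ-structure with universe {0,…,m} (so the universe is nonempty).
record Structure (σ : Vocab) : Set where
  field
    m   : ℕ
    rel : Interp σ (suc m)

open Structure public

-- Syntax of ESO universal Horn sentences
--   ∃ R₁ … ∃ R_k ∀ x₁ … x_v  ψ
-- σ = input vocabulary, τ = arities of the quantified relation variables,
-- v = number of universally quantified first-order variables.

record Atom (voc : Vocab) (v : ℕ) : Set where
  constructor atom
  field
    sym  : Sym voc
    args : Vec (Fin v) (arity voc sym)

data InLit (σ : Vocab) (v : ℕ) : Set where
  eqLit  : (positive : Bool) → Fin v → Fin v → InLit σ v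
  relLit : (positive : Bool) → Atom σ v → InLit σ v

-- a clause: arbitrary input literals, any number of negative second-order
-- atoms, and at most one positive second-order atom
record Clause (σ τ : Vocab) (v : ℕ) : Set where
  field
    inputLits : List (InLit σ v)
    negSO     : List (Atom τ v)
    posSO     : Maybe (Atom τ v)

record ESOHorn (σ : Vocab) : Set where
  field
    τ       : Vocab
    nvars   : ℕ
    clauses : List (Clause σ τ nvars)

evalAtom : ∀ {voc v N} → Interp voc N → (Fin v → Fin N) → Atom voc v → Bool
evalAtom I ρ (atom s xs) = I s (map ρ xs)

evalInLit : ∀ {σ v N} → Interp σ N → (Fin v → Fin N) → InLit σ v → Bool
evalInLit I ρ (eqLit true x y)  = ⌊ ρ x ≟ ρ y ⌋
evalInLit I ρ (eqLit false x y) = not ⌊ ρ x ≟ ρ y ⌋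
evalInLit I ρ (relLit true a)   = evalAtom I ρ a
evalInLit I ρ (relLit false a)  = not (evalAtom I ρ a)

evalPos : ∀ {τ v N} → Interp τ N → (Fin v → Fin N) → Maybe (Atom τ v) → Bool
evalPos R ρ (just a) = evalAtom R ρ a
evalPos R ρ nothing  = false

evalClause : ∀ {σ τ v N} → Interp σ N → Interp τ N → (Fin v → Fin N)
           → Clause σ τ v → Bool
evalClause I R ρ C =
  any (evalInLit I ρ) (Clause.inputLits C)
  ∨ any (λ a → not (evalAtom R ρ a)) (Clause.negSO C)
  ∨ evalPos R ρ (Clause.posSO C)

_⊨_ : ∀ {σ} → Structure σ → ESOHorn σ → Set
A ⊨ φ = Σ (Interp (ESOHorn.τ φ) (suc (m A))) λ R →
          (ρ : Fin (ESOHorn.nvars φ) → Fin (suc (m A))) →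
          all (evalClause (rel A) R ρ) (ESOHorn.clauses φ) ≡ true

-- Maximum Matching instances as structures with a successor relation
-- Vocabulary: symbol 0 = E (binary, edge relation), symbol 1 = S (binary,
-- successor), symbol 2 = P (unary; the bound K is encoded as K = |P|).

σMM : Vocab
σMM = 2 ∷ 2 ∷ 1 ∷ []

E-sym S-sym P-sym : Sym σMM
E-sym = fzero
S-sym = fsuc fzero
P-sym = fsuc (fsuc fzero)

module _ (A : Structure σMM) where
  private N = suc (m A)

  Edge : Fin N → Fin N → Bool
  Edge u w = rel A E-sym (u ∷ w ∷ [])

  IsSuccessor : Set
  IsSuccessor = ∀ (i j : Fin N) →
    rel A S-sym (i ∷ j ∷ []) ≡ (suc (toℕ i) ≡ᵇ toℕ j)

  IsSimpleGraph : Set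
  IsSimpleGraph = (∀ u → Edge u u ≡ false) × (∀ u w → Edge u w ≡ Edge w u)

  ValidInstance : Set
  ValidInstance = IsSuccessor × IsSimpleGraph

  K : ℕ
  K = length (filter (λ u → T? (rel A P-sym (u ∷ []))) (allFin N))

  -- a matching F ⊆ E, given as a list of edges {u,w} (written (u , w));
  -- any two entries at different positions share no endpoint
  -- (hence the edges are distinct and |F| = length F).
  Disjoint : (Fin N × Fin N) → (Fin N × Fin N) → Set
  Disjoint (a , b) (c , d) = a ≢ c × a ≢ d × b ≢ c × b ≢ d

  IsMatching : List (Fin N × Fin N) → Set
  IsMatching F =
    (∀ i → Edge (proj₁ (lookup F i)) (proj₂ (lookup F i)) ≡ true) ×
    (∀ i j → i ≢ j → Disjoint (lookup F i) (lookup F j))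

  MaxMatchingYes : Set
  MaxMatchingYes = ∃[ F ] (IsMatching F × K ≤ length F)

Expresses : ESOHorn σMM → Set
Expresses φ = ∀ (A : Structure σMM) → ValidInstance A → (A ⊨ φ ⇔ MaxMatchingYes A)

module Submission where

-- Universal first-order sentences are preserved under induced
-- substructures, and existentially quantifying relations does not change
-- this: if A ⊨ ∃R̄ ∀x̄ ψ via relations R̄, then every induced substructure
-- B of A satisfies the same sentence, witnessed by the restriction of R̄ to
-- B, because each assignment into B is also an assignment into A and every
-- literal takes the same truth value in B as in A.  (No Horn restriction is
-- needed.)  Maximum Matching, with the bound K given as the size of a unary
-- predicate P, is not closed under induced substructures, even among those
-- carrying a successor relation: the graph on {0,1,2} with the single edge
-- {1,2} and P = {0} is a yes-instance (K = 1), while its induced substructure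
-- on the initial segment {0} is a valid instance with K = 1 and no edges.

open import Defs
open import Data.Bool using (Bool; true; false; not; _∨_)
open import Data.Bool.Properties using (∨-comm)
open import Data.Bool.ListAction using (or; and)
open import Data.Fin using (Fin; toℕ; _≟_) renaming (zero to fzero; suc to fsuc)
open import Data.List using ([]; _∷_)
open import Data.List.Properties using (map-cong)
open import Data.Maybe using (Maybe; just; nothing)
open import Data.Nat using (ℕ; suc; _≡ᵇ_; s≤s; z≤n)
open import Data.Product using (Σ; _,_)
open import Data.Vec using (_∷_; []; map)
open import Data.Vec.Properties using (map-∘)
open import Function.Bundles using (Equivalence; mk⇔)
open import Function.Definitions using (Injective)
open import Relation.Nullary using (¬_; contradiction)
open import Relation.Nullary.Decidable using (⌊_⌋; isYes≗does; does-⇔)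
open import Relation.Binary.PropositionalEquality
  using (_≡_; refl; sym; trans; cong; cong₂)

-- The interpretation on Fin M induced by I along f : Fin M → Fin N; when f is
-- injective this is the induced substructure on the image of f.
pullback : ∀ {voc N M} → Interp voc N → (Fin M → Fin N) → Interp voc M
pullback I f s xs = I s (map f xs)

induced : ∀ {σ n} (A : Structure σ) → (Fin (suc n) → Fin (suc (m A))) → Structure σ
induced {σ} {n} A f = record { m = n ; rel = pullback {σ} (rel A) f }

evalAtom-pullback : ∀ {voc v N M} (I : Interp voc N) (f : Fin M → Fin N)
  (ρ : Fin v → Fin M) (a : Atom voc v) →
  evalAtom (pullback {voc} I f) ρ a ≡ evalAtom I (λ x → f (ρ x)) a
evalAtom-pullback I f ρ (atom s xs) = cong (I s) (sym (map-∘ f ρ xs))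

-- Injective maps decide equality exactly as the identity does; this is what
-- makes equality literals (and hence the sentence) survive restriction.
≟-injective : ∀ {M N} (f : Fin M → Fin N) → Injective _≡_ _≡_ f →
  ∀ a b → ⌊ a ≟ b ⌋ ≡ ⌊ f a ≟ f b ⌋
≟-injective f f-inj a b =
  trans (isYes≗does (a ≟ b))
    (trans (does-⇔ (mk⇔ (cong f) f-inj) (a ≟ b) (f a ≟ f b))
      (sym (isYes≗does (f a ≟ f b))))

module Restriction {σ τ : Vocab} {N M : ℕ}
  (I : Interp σ N) (R : Interp τ N)
  (f : Fin M → Fin N) (f-inj : Injective _≡_ _≡_ f) where

  I↾ : Interp σ M
  I↾ = pullback {σ} I f

  R↾ : Interp τ M
  R↾ = pullback {τ} R f

  evalInLit-pullback : ∀ {v} (ρ : Fin v → Fin M) (l : InLit σ v) →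
    evalInLit I↾ ρ l ≡ evalInLit I (λ x → f (ρ x)) l
  evalInLit-pullback ρ (eqLit true x y)  = ≟-injective f f-inj (ρ x) (ρ y)
  evalInLit-pullback ρ (eqLit false x y) = cong not (≟-injective f f-inj (ρ x) (ρ y))
  evalInLit-pullback ρ (relLit true a)   = evalAtom-pullback {σ} I f ρ a
  evalInLit-pullback ρ (relLit false a)  = cong not (evalAtom-pullback {σ} I f ρ a)

  evalPos-pullback : ∀ {v} (ρ : Fin v → Fin M) (p : Maybe (Atom τ v)) →
    evalPos R↾ ρ p ≡ evalPos R (λ x → f (ρ x)) p
  evalPos-pullback ρ (just a)  = evalAtom-pullback {τ} R f ρ a
  evalPos-pullback ρ nothing   = refl

  evalClause-pullback : ∀ {v} (ρ : Fin v → Fin M) (C : Clause σ τ v) →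
    evalClause I↾ R↾ ρ C ≡ evalClause I R (λ x → f (ρ x)) C
  evalClause-pullback ρ C =
    cong₂ _∨_ (cong or (map-cong (evalInLit-pullback ρ) (Clause.inputLits C)))
      (cong₂ _∨_
        (cong or (map-cong (λ a → cong not (evalAtom-pullback {τ} R f ρ a)) (Clause.negSO C)))
        (evalPos-pullback ρ (Clause.posSO C)))

⊨-induced : ∀ {σ n} (φ : ESOHorn σ) (A : Structure σ)
  (f : Fin (suc n) → Fin (suc (m A))) → Injective _≡_ _≡_ f →
  A ⊨ φ → induced A f ⊨ φ
⊨-induced {σ} φ A f f-inj (R , A⊨ψ) = R↾ , λ ρ →
  trans (cong and (map-cong (evalClause-pullback ρ) (ESOHorn.clauses φ)))
        (A⊨ψ (λ x → f (ρ x)))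
  where open Restriction {σ} {ESOHorn.τ φ} (rel A) R f f-inj

arc₁₂ : Fin 3 → Fin 3 → Bool
arc₁₂ (fsuc fzero) (fsuc (fsuc fzero)) = true
arc₁₂ _            _                   = false

edge₃ : Fin 3 → Fin 3 → Bool
edge₃ u w = arc₁₂ u w ∨ arc₁₂ w u

G₃ : Structure σMM
G₃ = record { m = 2 ; rel = rel₃ }
  where
  rel₃ : Interp σMM 3
  rel₃ fzero               (u ∷ w ∷ []) = edge₃ u w
  rel₃ (fsuc fzero)        (i ∷ j ∷ []) = suc (toℕ i) ≡ᵇ toℕ j
  rel₃ (fsuc (fsuc fzero)) (u ∷ [])     = isZero u
    where
    isZero : Fin 3 → Bool
    isZero fzero = true
    isZero _     = false

G₃-valid : ValidInstance G₃
G₃-valid = (λ i j → refl) , (irreflexive , λ u w → ∨-comm (arc₁₂ u w) (arc₁₂ w u))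
  where
  irreflexive : ∀ u → edge₃ u u ≡ false
  irreflexive fzero               = refl
  irreflexive (fsuc fzero)        = refl
  irreflexive (fsuc (fsuc fzero)) = refl

G₃-yes : MaxMatchingYes G₃
G₃-yes = (fsuc fzero , fsuc (fsuc fzero)) ∷ [] ,
  ((λ { fzero → refl }) , (λ { fzero fzero 0≢0 → contradiction refl 0≢0 })) ,
  s≤s z≤n

initial : Fin 1 → Fin 3
initial _ = fzero

initial-injective : Injective _≡_ _≡_ initial
initial-injective {fzero} {fzero} _ = refl

G₁ : Structure σMM
G₁ = induced G₃ initial

G₁-valid : ValidInstance G₁
G₁-valid = (λ { fzero fzero → refl }) , ((λ { fzero → refl }) , λ { fzero fzero → refl })

G₁-no : ¬ MaxMatchingYes G₁
G₁-no ([] , _ , ())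
G₁-no ((fzero , fzero) ∷ _ , (in-E , _) , _) = contradiction (in-E fzero) λ ()

lemma1 : ¬ (Σ (ESOHorn σMM) λ φ → Expresses φ)
lemma1 (φ , expresses) = G₁-no (to (expresses G₁ G₁-valid) G₁⊨φ)
  where
  open Equivalence using (to; from)

  G₃⊨φ : G₃ ⊨ φ
  G₃⊨φ = from (expresses G₃ G₃-valid) G₃-yes

  G₁⊨φ : G₁ ⊨ φ
  G₁⊨φ = ⊨-induced φ G₃ initial initial-injective G₃⊨φ
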